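{- Let $n\ge3$ be odd, let $f,B_0,C$ be nonzero integers with $B_0\neq-1$ squarefree and $\gcd(f,C)=1$, put $B=f^2B_0$, and suppose $2^r\|f$ with $r>0$. If $t>r+1$ then $\mathcal{Y}_{B,C}(\mathbb{Z};*_2^t)=\emptyset$. For $0<t\le r+1$: $\mathcal{Y}_{B,C}(\mathbb{Z};\tilde*_2^{t-1})=\emptyset$ if $0<t\le r$, and $\mathcal{Y}_{B,C}(\mathbb{Z};\tilde*_2^{t-1})\cong\mathcal{Y}_{B2^{ -2r},\,C2^{\lceil 2r/n\rceil n-2r}}(\mathbb{Z};\tilde*_2^0)$ if $t=r+1$; and, writing $\mathcal{Y}_{B,C}(\mathbb{Z};\tilde*_2^{t-1})^c$ for the complement of $\mathcal{Y}_{B,C}(\mathbb{Z};\tilde*_2^{t-1})$ in $\mathcal{Y}_{B,C}(\mathbb{Z};*_2^t)$: it is empty if $0<t<r$ and $n\nmid t$; it is isomorphic to $\mathcal{Y}_{B2^{ -2t},C}(\mathbb{Z};*_2^0,2\nmid y)$ if $0<t\le r$ and $n\mid t$; it is isomorphic to $\mathcal{Y}_{B2^{ -2r},\,C2^{\lceil 2r/n\rceil n-2r}}(\mathbb{Z};*_2^0)$ if $t=r$ and $n\nmid t$; it is empty if $t=r+1$.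
   Context: For nonzero integers $B',C'$, $\mathcal{Y}_{B',C'}(\mathbb{Z})$ is the groupoid of primitive integer solutions $[x:y:z]$ of $x^2+B'y^2=C'z^n$, and $\mathcal{Y}_{B',C'}(\mathbb{Z};\text{conditions})$ the full subgroupoid satisfying the conditions. Writing $B'=f'^2B_0$ with the same squarefree $B_0$ (i.e. $f'=f/2^t$ or $f/2^r$), put $u=x+f'\sqrt{ -B_0}\,y\in\mathcal{O}_K$, $K=\mathbb{Q}(\sqrt{ -B_0})$. For $s\ge0$: $2^s\|u$ means $u\in2^s\mathcal{O}_K\smallsetminus2^{s+1}\mathcal{O}_K$; condition $*_2^s$ means $2^s\|u$; condition $\tilde*_2^s$ means $2^{s+1}\|u$ and $v_2(x)=s$. -}

module Defs where

open import Data.Nat as ℕ using (ℕ; zero; suc)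
open import Data.Integer hiding (suc)
open import Data.Integer.Properties
open import Data.Integer.Divisibility using (_∣_)
open import Data.Product
open import Data.Sum
open import Relation.Nullary
open import Relation.Binary.PropositionalEquality

-- Let d = -B₀ (squarefree, d ≠ 1), K = ℚ(√d), O_K = ℤ[ω] with
-- ω = (1+√d)/2 if d ≡ 1 mod 4 and ω = √d otherwise.
-- InMOK d m a b  :⇔  a + b√d ∈ m·O_K, i.e. a + b√d = m(p + qω), p,q ∈ ℤ.
InMOK : (d m a b : ℤ) → Set
InMOK d m a b =
    ((+ 4) ∣ (d - 1ℤ) ×
       (Σ ℤ λ p → Σ ℤ λ q → ((+ 2) * a ≡ m * ((+ 2) * p + q)) × ((+ 2) * b ≡ m * q)))
  ⊎ ((¬ ((+ 4) ∣ (d - 1ℤ))) ×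
       (Σ ℤ λ p → Σ ℤ λ q → (a ≡ m * p) × (b ≡ m * q)))

Exact2 : (d : ℤ) (s : ℕ) (a b : ℤ) → Set
Exact2 d s a b = InMOK d ((+ 2) ^ s) a b × ¬ InMOK d ((+ 2) ^ suc s) a b

V2is : (s : ℕ) (x : ℤ) → Set
V2is s x = ((+ 2) ^ s ∣ x) × ¬ ((+ 2) ^ suc s ∣ x)

-- A condition on a solution [x:y:z] of x² + f'²B₀ y² = C' zⁿ,
-- given as a predicate in (f', B₀, x, y, z).
Cond : Set₁
Cond = (f' B₀ x y z : ℤ) → Set

star : ℕ → Cond
star s f' B₀ x y z = Exact2 (- B₀) s x (f' * y)

tstar : ℕ → Cond
tstar s f' B₀ x y z = Exact2 (- B₀) (suc s) x (f' * y) × V2is s x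

_∧c_ : Cond → Cond → Cond
(P ∧c Q) f' B₀ x y z = P f' B₀ x y z × Q f' B₀ x y z

notc : Cond → Cond
notc P f' B₀ x y z = ¬ P f' B₀ x y z

yOdd : Cond
yOdd f' B₀ x y z = ¬ ((+ 2) ∣ y)

-- The groupoid 𝒴_{B',C'}(ℤ; P), B' = f'² B₀, for the weighted
-- projective stack with weights (n, n, 2): objects are primitive
-- integer solutions, morphisms λ ∈ ℤˣ with (λⁿx, λⁿy, λ²z) = (x',y',z').

record Obj (n : ℕ) (f' B₀ C' : ℤ) (P : Cond) : Set where
  constructor sol
  field
    x y z : ℤ
    eqn   : x * x + (f' * f' * B₀) * (y * y) ≡ C' * z ^ n
    prim  : ∀ (d : ℤ) → d ∣ x → d ∣ y → d ∣ z → d ∣ 1ℤ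
    cond  : P f' B₀ x y z
open Obj public

record Hom {n : ℕ} {f' B₀ C' : ℤ} {P : Cond} (a b : Obj n f' B₀ C' P) : Set where
  constructor hom
  field
    unit : ℤ
    isUnit : unit * unit ≡ 1ℤ
    actx : unit ^ n * x a ≡ x b
    acty : unit ^ n * y a ≡ y b
    actz : unit ^ 2 * z a ≡ z b
open Hom public

private
  pow-* : ∀ a b k → (a * b) ^ k ≡ a ^ k * b ^ k
  pow-* a b zero = refl
  pow-* a b (suc k) = begin
      (a * b) * (a * b) ^ k      ≡⟨ cong ((a * b) *_) (pow-* a b k) ⟩
      (a * b) * (a ^ k * b ^ k)  ≡⟨ *-assoc a b (a ^ k * b ^ k) ⟩
      a * (b * (a ^ k * b ^ k))  ≡⟨ cong (a *_) (sym (*-assoc b (a ^ k) (b ^ k))) ⟩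
      a * ((b * a ^ k) * b ^ k)  ≡⟨ cong (λ w → a * (w * b ^ k)) (*-comm b (a ^ k)) ⟩
      a * ((a ^ k * b) * b ^ k)  ≡⟨ cong (a *_) (*-assoc (a ^ k) b (b ^ k)) ⟩
      a * (a ^ k * (b * b ^ k))  ≡⟨ sym (*-assoc a (a ^ k) (b * b ^ k)) ⟩
      (a * a ^ k) * (b * b ^ k)  ∎
    where open ≡-Reasoning

  act-comp : ∀ μ l k w w' w'' → l ^ k * w ≡ w' → μ ^ k * w' ≡ w'' →
             (μ * l) ^ k * w ≡ w''
  act-comp μ l k w w' w'' p q = begin
      (μ * l) ^ k * w      ≡⟨ cong (_* w) (pow-* μ l k) ⟩
      μ ^ k * l ^ k * w    ≡⟨ *-assoc (μ ^ k) (l ^ k) w ⟩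
      μ ^ k * (l ^ k * w)  ≡⟨ cong (μ ^ k *_) p ⟩
      μ ^ k * w'           ≡⟨ q ⟩
      w''                  ∎
    where open ≡-Reasoning

  act-one : ∀ k w → 1ℤ ^ k * w ≡ w
  act-one k w = trans (cong (_* w) (^-zeroˡ k)) (*-identityˡ w)

idHom : ∀ {n f' B₀ C' P} (a : Obj n f' B₀ C' P) → Hom a a
idHom {n} a = hom 1ℤ refl (act-one n (x a)) (act-one n (y a)) (act-one 2 (z a))

_∘H_ : ∀ {n f' B₀ C' P} {a b c : Obj n f' B₀ C' P} → Hom b c → Hom a b → Hom a c
_∘H_ {n} {a = a} {b} {c} g h = hom (unit g * unit h) u-proof
    (act-comp (unit g) (unit h) n (x a) (x b) (x c) (actx h) (actx g))
    (act-comp (unit g) (unit h) n (y a) (y b) (y c) (acty h) (acty g))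
    (act-comp (unit g) (unit h) 2 (z a) (z b) (z c) (actz h) (actz g))
  where
    open ≡-Reasoning
    u-proof : (unit g * unit h) * (unit g * unit h) ≡ 1ℤ
    u-proof = begin
      (unit g * unit h) * (unit g * unit h)
        ≡⟨ cong ((unit g * unit h) *_) (sym (*-identityʳ (unit g * unit h))) ⟩
      (unit g * unit h) ^ 2
        ≡⟨ pow-* (unit g) (unit h) 2 ⟩
      unit g ^ 2 * unit h ^ 2
        ≡⟨ cong₂ _*_ (trans (cong (unit g *_) (*-identityʳ (unit g))) (isUnit g))
                     (trans (cong (unit h *_) (*-identityʳ (unit h))) (isUnit h)) ⟩
      1ℤ ∎

-- Equivalence of groupoids 𝒴_{f₁²B₀,C₁}(ℤ;P) ≃ 𝒴_{f₂²B₀,C₂}(ℤ;Q):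
-- a functor that is fully faithful and essentially surjective.
-- (Morphisms are compared via their underlying unit λ.)
record GpdEquiv (n : ℕ) (B₀ f₁ C₁ : ℤ) (P : Cond) (f₂ C₂ : ℤ) (Q : Cond) : Set where
  field
    F₀ : Obj n f₁ B₀ C₁ P → Obj n f₂ B₀ C₂ Q
    F₁ : ∀ {a b} → Hom a b → Hom (F₀ a) (F₀ b)
    F-id : ∀ a → unit (F₁ (idHom a)) ≡ 1ℤ
    F-∘ : ∀ {a b c} (g : Hom b c) (h : Hom a b) →
          unit (F₁ (g ∘H h)) ≡ unit (F₁ g) * unit (F₁ h)
    faithful : ∀ {a b} (g h : Hom a b) → unit (F₁ g) ≡ unit (F₁ h) → unit g ≡ unit h
    full : ∀ {a b} (h : Hom (F₀ a) (F₀ b)) → Σ (Hom a b) λ g → unit (F₁ g) ≡ unit h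
    essSurj : ∀ (b : Obj n f₂ B₀ C₂ Q) → Σ (Obj n f₁ B₀ C₁ P) λ a → Hom (F₀ a) b

-- ⌈ m / n ⌉ for natural numbers (n > 0; value 0 for n = 0, unused)
ceilDiv : ℕ → ℕ → ℕ
ceilDiv m zero = 0
ceilDiv m (suc k) = (m ℕ.+ k) Data.Nat.DivMod./ suc k
  where import Data.Nat.DivMod

SquarefreeZ : ℤ → Set
SquarefreeZ B₀ = ∀ (d : ℤ) → d * d ∣ B₀ → d ∣ 1ℤ

{-# OPTIONS --safe #-}
-- Write u = x + f y √-B₀.  As 2 ∣ f and gcd(f, C) = 1, C is odd, so by primitivity x and y
-- are never both even.  Every element of 2m·O_K is m((2p + q) + q √-B₀), so u ∈ 2m·O_K
-- forces m ∣ x, m ∣ f y and x ≡ f y (mod 2m); with 2ʳ ‖ f this pins down v₂(x) and gives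
-- the empty cases.  When 2ᵃ divides x and f, the equation reads 4ᵃ (x′² + f′² B₀ y²) = C zⁿ,
-- so 2^⌈2a/n⌉ ∣ z, and (x, y, z) ↦ (x / 2ᵃ, y, z / 2^⌈2a/n⌉) is an equivalence onto the
-- solutions for f′ = f / 2ᵃ and C·2^(⌈2a/n⌉n − 2a): these are the three equivalences.  If
-- moreover x′² + f′² B₀ y² is odd, comparing powers of 2 in C zⁿ gives n ∣ 2a, which
-- empties the complement of ~*₂^(t-1) in *₂ᵗ for 0 < t < r with n ∤ t.
module Submission where

open import Defs
open import Data.Nat as ℕ using (ℕ; zero; suc; s≤s; z≤n)
import Data.Nat.Properties as ℕP
open import Data.Nat.Divisibility as ℕD using ()
import Data.Nat.DivMod as ℕM
import Data.Nat.Coprimality as ℕC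
open import Data.Nat.Primality using (euclidsLemma; prime[2])
open import Data.Integer hiding (suc; ∣_∣)
import Data.Integer.Base as ℤ
open import Data.Integer.Properties
open import Algebra.Properties.CommutativeSemigroup *-commutativeSemigroup
  using (interchange; x∙yz≈y∙xz; xy∙z≈zx∙y)
-- Defs states primitivity, V2is and yOdd with unsigned divisibility; the proofs use signed.
import Data.Integer.Divisibility as Unsigned
open import Data.Integer.Divisibility.Signed
open import Data.Integer.Coprimality using (Coprime; coprime-divisor)
open import Data.Integer.Tactic.RingSolver using (solve-∀)
open import Data.Product
open import Data.Product.Function.NonDependent.Propositional using (_×-⇔_)
open import Data.Sum using (_⊎_; inj₁; inj₂; [_,_]′)
import Data.Sum as Sum
open import Data.Empty using (⊥-elim)
open import Function using (_∘_; id; case_of_)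
open import Function.Bundles using (_⇔_; mk⇔; Equivalence)
open import Function.Related.TypeIsomorphisms using (¬-cong-⇔)
open import Relation.Nullary using (¬_; yes; no)
open import Relation.Binary.PropositionalEquality

open Equivalence using (to; from)

private variable
  a b d k m B₀ C C₁ f f₁ X X₁ Y Z Z′ : ℤ
  i j n r t : ℕ
  P : Cond

Even Odd : ℤ → Set
Even m = (+ 2) ∣ m
Odd m = ¬ Even m

even[m*n]⇒even[m]⊎even[n] : ∀ m n → Even (m * n) → Even m ⊎ Even n
even[m*n]⇒even[m]⊎even[n] m n 2∣mn = Sum.map ∣ᵤ⇒∣ ∣ᵤ⇒∣
  (euclidsLemma ℤ.∣ m ∣ ℤ.∣ n ∣ prime[2] (subst (2 ℕD.∣_) (abs-* m n) (∣⇒∣ᵤ 2∣mn)))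

odd-1 : Odd 1ℤ
odd-1 2∣1 with () ← ℕD.∣1⇒≡1 (∣⇒∣ᵤ 2∣1)

odd-* : ∀ {m n} → Odd m → Odd n → Odd (m * n)
odd-* {m} {n} om on = [ om , on ]′ ∘ even[m*n]⇒even[m]⊎even[n] m n

even[m^k]⇒even[m] : ∀ {m} k → Even (m ^ k) → Even m
even[m^k]⇒even[m] zero    2∣1  = ⊥-elim (odd-1 2∣1)
even[m^k]⇒even[m] {m} (suc k) 2∣mᵏ⁺¹ =
  [ id , even[m^k]⇒even[m] k ]′ (even[m*n]⇒even[m]⊎even[n] m (m ^ k) 2∣mᵏ⁺¹)

odd-^ : ∀ {m} k → Odd m → Odd (m ^ k)
odd-^ k om = om ∘ even[m^k]⇒even[m] k

even[m*m+n]⇒even[m] : ∀ {m n} → Even n → Even (m * m + n) → Even m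
even[m*m+n]⇒even[m] {m} 2∣n 2∣m²+n =
  [ id , id ]′ (even[m*n]⇒even[m]⊎even[n] m m (∣m+n∣n⇒∣m 2∣m²+n 2∣n))

¬2∣⇒coprime-2 : ∀ {m} → ¬ (2 ℕD.∣ m) → ℕC.Coprime m 2
¬2∣⇒coprime-2 _   {zero}              (_ , 0∣2) with () ← ℕD.0∣⇒≡0 0∣2
¬2∣⇒coprime-2 _   {suc zero}          _         = refl
¬2∣⇒coprime-2 2∤m {suc (suc zero)}    (2∣m , _) = ⊥-elim (2∤m 2∣m)
¬2∣⇒coprime-2 _   {suc (suc (suc _))} (_ , i∣2) with s≤s (s≤s ()) ← ℕD.∣⇒≤ i∣2

odd∣2*⇒∣ : ∀ {n m} → ¬ (2 ℕD.∣ n) → n ℕD.∣ 2 ℕ.* m → n ℕD.∣ m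
odd∣2*⇒∣ 2∤n = ℕC.coprime-divisor (¬2∣⇒coprime-2 2∤n)

coprime-even⇒odd : Coprime a b → Even a → Odd b
coprime-even⇒odd a⊥b 2∣a 2∣b with () ← a⊥b (∣⇒∣ᵤ 2∣a , ∣⇒∣ᵤ 2∣b)

2^_ : ℕ → ℤ
2^ k = (+ 2) ^ k

2^-nonZero : ∀ i → NonZero (2^ i)
2^-nonZero i = ≢-nonZero λ 2ⁱ≡0 → case i^n≡0⇒i≡0 (+ 2) i 2ⁱ≡0 of λ ()

quotient-≡ : (k∣m : k ∣ m) → m ≡ k * quotient k∣m
quotient-≡ {k} (divides q m≡) = trans m≡ (*-comm q k)

^-distrib-* : ∀ m n k → (m * n) ^ k ≡ m ^ k * n ^ k
^-distrib-* m n zero    = refl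
^-distrib-* m n (suc k) = begin
  m * n * (m * n) ^ k     ≡⟨ cong (m * n *_) (^-distrib-* m n k) ⟩
  m * n * (m ^ k * n ^ k) ≡⟨ interchange m n (m ^ k) (n ^ k) ⟩
  m * m ^ k * (n * n ^ k) ∎
  where open ≡-Reasoning

2^-+-comm : ∀ i j → 2^ (i ℕ.+ j) ≡ 2^ j * 2^ i
2^-+-comm i j = trans (^-distribˡ-+-* (+ 2) i j) (*-comm (2^ i) (2^ j))

2^-double : ∀ i → 2^ (2 ℕ.* i) ≡ 2^ i * 2^ i
2^-double i = trans (cong 2^_ (cong (i ℕ.+_) (ℕP.+-identityʳ i))) (^-distribˡ-+-* (+ 2) i i)

2^-mono-∣ : i ℕ.≤ j → 2^ i ∣ 2^ j
2^-mono-∣ {i} {j} i≤j = divides (2^ (j ℕ.∸ i))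
  (trans (cong 2^_ (sym (ℕP.m∸n+n≡m i≤j))) (^-distribˡ-+-* (+ 2) (j ℕ.∸ i) i))

2^[i+j]∣2^j*⇔ : ∀ i j {m} → 2^ (i ℕ.+ j) ∣ 2^ j * m ⇔ 2^ i ∣ m
2^[i+j]∣2^j*⇔ i j {m} = subst (λ e → e ∣ 2^ j * m ⇔ 2^ i ∣ m) (sym (2^-+-comm i j))
  (mk⇔ (*-cancelˡ-∣ (2^ j) {{2^-nonZero j}}) (*-monoʳ-∣ (2^ j)))

2^∣2^*odd⇒≤ : Odd m → 2^ i ∣ 2^ j * m → i ℕ.≤ j
2^∣2^*odd⇒≤ {i = i} {j} om 2^i∣2^jm with i ℕ.≤? j
... | yes i≤j = i≤j
... | no  i≰j = ⊥-elim (om (to (2^[i+j]∣2^j*⇔ 1 j) (∣-trans (2^-mono-∣ (ℕP.≰⇒> i≰j)) 2^i∣2^jm)))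

2^-factor : ∀ i m → (∃₂ λ j m′ → m ≡ 2^ j * m′ × Odd m′) ⊎ 2^ i ∣ m
2^-factor zero    m = inj₂ (divides m (sym (*-identityʳ m)))
2^-factor (suc i) m with (+ 2) ∣? m
... | no  m-odd = inj₁ (0 , m , sym (*-identityˡ m) , m-odd)
... | yes (divides m′ refl) with 2^-factor i m′
...   | inj₁ (j , m″ , refl , m″-odd) = inj₁ (suc j , m″ , xy∙z≈zx∙y (2^ j) m″ (+ 2) , m″-odd)
...   | inj₂ 2^i∣m′ = inj₂ (subst (_∣ m′ * + 2) (*-comm (2^ i) (+ 2)) (*-monoˡ-∣ (+ 2) 2^i∣m′))

-- The power of two in C zⁿ for odd C

C*[2^i*m]^n≡ : ∀ c i m n → c * (2^ i * m) ^ n ≡ 2^ (i ℕ.* n) * (c * m ^ n)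
C*[2^i*m]^n≡ c i m n = begin
  c * (2^ i * m) ^ n        ≡⟨ cong (c *_) (^-distrib-* (2^ i) m n) ⟩
  c * ((2^ i) ^ n * m ^ n)  ≡⟨ cong (λ e → c * (e * m ^ n)) (^-*-assoc (+ 2) i n) ⟩
  c * (2^ (i ℕ.* n) * m ^ n) ≡⟨ x∙yz≈y∙xz c (2^ (i ℕ.* n)) (m ^ n) ⟩
  2^ (i ℕ.* n) * (c * m ^ n) ∎
  where open ≡-Reasoning

2^∣C*zⁿ⇒2^∣z : ∀ {C z} n {i j} → Odd C → (∀ l → i ℕ.≤ l ℕ.* n → j ℕ.≤ l) →
               2^ i ∣ C * z ^ n → 2^ j ∣ z
2^∣C*zⁿ⇒2^∣z {C} {z} n {i} {j} C-odd j-least 2^i∣Czⁿ with 2^-factor j z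
... | inj₂ 2^j∣z = 2^j∣z
... | inj₁ (l , z′ , refl , z′-odd) = ∣-trans (2^-mono-∣ (j-least l i≤ln)) (∣m⇒∣m*n z′ ∣-refl)
  where
  i≤ln : i ℕ.≤ l ℕ.* n
  i≤ln = 2^∣2^*odd⇒≤ (odd-* C-odd (odd-^ n z′-odd))
    (subst (2^ i ∣_) (C*[2^i*m]^n≡ C l z′ n) 2^i∣Czⁿ)

C*zⁿ≡2^i*odd⇒n∣i : ∀ {C z m} n .{{_ : ℕ.NonZero n}} {i} → Odd C → Odd m →
                   C * z ^ n ≡ 2^ i * m → n ℕD.∣ i
C*zⁿ≡2^i*odd⇒n∣i {C} {z} {m} n@(suc n′) {i} C-odd m-odd Czⁿ≡ with 2^-factor (suc i) z
... | inj₁ (l , z′ , refl , z′-odd) =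
  ℕD.divides l (ℕP.≤-antisym
    (2^∣2^*odd⇒≤ u-odd (subst (2^ i ∣_) 2ⁱm≡ (∣m⇒∣m*n m ∣-refl)))
    (2^∣2^*odd⇒≤ m-odd (subst (2^ (l ℕ.* n) ∣_) (sym 2ⁱm≡) (∣m⇒∣m*n _ ∣-refl))))
  where
  u-odd : Odd (C * z′ ^ n)
  u-odd = odd-* C-odd (odd-^ n z′-odd)
  2ⁱm≡ : 2^ i * m ≡ 2^ (l ℕ.* n) * (C * z′ ^ n)
  2ⁱm≡ = trans (sym Czⁿ≡) (C*[2^i*m]^n≡ C l z′ n)
... | inj₂ 2^[1+i]∣z = ⊥-elim (ℕP.n≮n i (2^∣2^*odd⇒≤ m-odd (subst (2^ suc i ∣_) Czⁿ≡ 2^[1+i]∣Czⁿ)))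
  where
  2^[1+i]∣Czⁿ : 2^ suc i ∣ C * z ^ n
  2^[1+i]∣Czⁿ = ∣n⇒∣m*n C (∣-trans 2^[1+i]∣z (∣m⇒∣m*n (z ^ n′) ∣-refl))

ceilDiv-upper : ∀ i n .{{_ : ℕ.NonZero n}} → i ℕ.≤ ceilDiv i n ℕ.* n
ceilDiv-upper i (suc n′) = ℕP.+-cancelʳ-≤ n′ i (q ℕ.* suc n′) (begin
    i ℕ.+ n′             ≡⟨ ℕM.m≡m%n+[m/n]*n (i ℕ.+ n′) (suc n′) ⟩
    ρ ℕ.+ q ℕ.* suc n′   ≤⟨ ℕP.+-monoˡ-≤ (q ℕ.* suc n′) (ℕP.≤-pred (ℕM.m%n<n (i ℕ.+ n′) (suc n′))) ⟩
    n′ ℕ.+ q ℕ.* suc n′  ≡⟨ ℕP.+-comm n′ (q ℕ.* suc n′) ⟩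
    q ℕ.* suc n′ ℕ.+ n′  ∎)
  where
  open ℕP.≤-Reasoning
  q = (i ℕ.+ n′) ℕM./ suc n′
  ρ = (i ℕ.+ n′) ℕM.% suc n′

ceilDiv-least : ∀ i n .{{_ : ℕ.NonZero n}} l → i ℕ.≤ l ℕ.* n → ceilDiv i n ℕ.≤ l
ceilDiv-least i (suc n′) l i≤ln =
  ℕP.≤-pred (ℕM.m<n*o⇒m/o<n {i ℕ.+ n′} {suc l} {suc n′} (begin-strict
    i ℕ.+ n′                 ≤⟨ ℕP.+-monoˡ-≤ n′ i≤ln ⟩
    l ℕ.* suc n′ ℕ.+ n′      <⟨ ℕP.+-monoʳ-< (l ℕ.* suc n′) (ℕP.n<1+n n′) ⟩
    l ℕ.* suc n′ ℕ.+ suc n′  ≡⟨ ℕP.+-comm (l ℕ.* suc n′) (suc n′) ⟩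
    suc l ℕ.* suc n′         ∎))
  where open ℕP.≤-Reasoning

-- Membership in m·O_K

module _ (D : ℤ) where

  InMOK-∣ : m ∣ a → m ∣ b → InMOK D m a b
  InMOK-∣ {m} (divides a′ refl) (divides b′ refl) with 4 ℕD.∣? ℤ.∣ D - 1ℤ ∣
  ... | yes 4∣D-1 = inj₁ (4∣D-1 , a′ - b′ , (+ 2) * b′ , 2a≡ m a′ b′ , 2b≡ m b′)
    where
    2a≡ : ∀ m a′ b′ → (+ 2) * (a′ * m) ≡ m * ((+ 2) * (a′ - b′) + (+ 2) * b′)
    2a≡ = solve-∀
    2b≡ : ∀ m b′ → (+ 2) * (b′ * m) ≡ m * ((+ 2) * b′)
    2b≡ = solve-∀
  ... | no  4∤D-1 = inj₂ (4∤D-1 , a′ , b′ , *-comm a′ m , *-comm b′ m)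

  InMOK-2*⇒coords : ∀ m → InMOK D ((+ 2) * m) a b →
                    ∃₂ λ p q → a ≡ m * ((+ 2) * p + q) × b ≡ m * q
  InMOK-2*⇒coords m (inj₁ (_ , p , q , 2a≡ , 2b≡)) = p , q , halve 2a≡ , halve 2b≡
    where
    halve : ∀ {e g} → (+ 2) * e ≡ (+ 2) * m * g → e ≡ m * g
    halve eq = *-cancelˡ-≡ (+ 2) _ _ (trans eq (*-assoc (+ 2) m _))
  InMOK-2*⇒coords m (inj₂ (_ , p , q , refl , refl)) = p - q , (+ 2) * q , a≡ m p q , b≡ m q
    where
    a≡ : ∀ m p q → (+ 2) * m * p ≡ m * ((+ 2) * (p - q) + (+ 2) * q)
    a≡ = solve-∀
    b≡ : ∀ m q → (+ 2) * m * q ≡ m * ((+ 2) * q)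
    b≡ = solve-∀

  InMOK-2*⇒∣ : ∀ m → InMOK D ((+ 2) * m) a b → m ∣ a × m ∣ b
  InMOK-2*⇒∣ m u∈ with p , q , refl , refl ← InMOK-2*⇒coords m u∈ =
    divides ((+ 2) * p + q) (*-comm m _) , divides q (*-comm m q)

  InMOK-2*⇒∣[a-b] : ∀ m → InMOK D ((+ 2) * m) a b → (+ 2) * m ∣ a - b
  InMOK-2*⇒∣[a-b] m u∈ with p , q , refl , refl ← InMOK-2*⇒coords m u∈ = divides p (a-b≡ m p q)
    where
    a-b≡ : ∀ m p q → m * ((+ 2) * p + q) - m * q ≡ p * ((+ 2) * m)
    a-b≡ = solve-∀

  InMOK-2*-∣ʳ⇒∣ˡ : ∀ m → InMOK D ((+ 2) * m) a b → (+ 2) * m ∣ b → (+ 2) * m ∣ a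
  InMOK-2*-∣ʳ⇒∣ˡ m u∈ 2m∣b = ∣m+n∣n⇒∣m (InMOK-2*⇒∣[a-b] m u∈) (∣m⇒∣-m 2m∣b)

  InMOK-2*-∣ˡ⇒∣ʳ : ∀ m → InMOK D ((+ 2) * m) a b → (+ 2) * m ∣ a → (+ 2) * m ∣ b
  InMOK-2*-∣ˡ⇒∣ʳ {b = b} m u∈ 2m∣a =
    subst (_ ∣_) (neg-involutive b) (∣m⇒∣-m (∣m+n∣m⇒∣n (InMOK-2*⇒∣[a-b] m u∈) 2m∣a))

  InMOK-2^-∣ʳ⇒∣ˡ : ∀ i → InMOK D (2^ i) a b → 2^ i ∣ b → 2^ i ∣ a
  InMOK-2^-∣ʳ⇒∣ˡ {a = a} zero    _ _ = divides a (sym (*-identityʳ a))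
  InMOK-2^-∣ʳ⇒∣ˡ         (suc i) = InMOK-2*-∣ʳ⇒∣ˡ (2^ i)

  InMOK-*⇔ : ∀ k m .{{_ : NonZero k}} → InMOK D (k * m) (k * a) (k * b) ⇔ InMOK D m a b
  InMOK-*⇔ {a} {b} k m = mk⇔ shrink expand
    where
    cancel : ∀ {e g} → k * e ≡ k * m * g → e ≡ m * g
    cancel eq = *-cancelˡ-≡ k _ _ (trans eq (*-assoc k m _))
    uncancel : ∀ {e g} → e ≡ m * g → k * e ≡ k * m * g
    uncancel {g = g} eq = trans (cong (k *_) eq) (sym (*-assoc k m g))
    2*-comm : ∀ e → (+ 2) * (k * e) ≡ k * ((+ 2) * e)
    2*-comm = x∙yz≈y∙xz (+ 2) k
    shrink : InMOK D (k * m) (k * a) (k * b) → InMOK D m a b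
    shrink (inj₁ (h , p , q , e₁ , e₂)) =
      inj₁ (h , p , q , cancel (trans (sym (2*-comm a)) e₁) , cancel (trans (sym (2*-comm b)) e₂))
    shrink (inj₂ (h , p , q , e₁ , e₂)) = inj₂ (h , p , q , cancel e₁ , cancel e₂)
    expand : InMOK D m a b → InMOK D (k * m) (k * a) (k * b)
    expand (inj₁ (h , p , q , e₁ , e₂)) =
      inj₁ (h , p , q , trans (2*-comm a) (uncancel e₁) , trans (2*-comm b) (uncancel e₂))
    expand (inj₂ (h , p , q , e₁ , e₂)) = inj₂ (h , p , q , uncancel e₁ , uncancel e₂)

  InMOK-2^*⇔ : ∀ i j → InMOK D (2^ (i ℕ.+ j)) (2^ j * a) (2^ j * b) ⇔ InMOK D (2^ i) a b
  InMOK-2^*⇔ {a} {b} i j = subst (λ e → InMOK D e (2^ j * a) (2^ j * b) ⇔ InMOK D (2^ i) a b)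
    (sym (2^-+-comm i j)) (InMOK-*⇔ (2^ j) (2^ i) {{2^-nonZero j}})

  Exact2-2^*⇔ : ∀ i j → Exact2 D (i ℕ.+ j) (2^ j * a) (2^ j * b) ⇔ Exact2 D i a b
  Exact2-2^*⇔ i j = InMOK-2^*⇔ i j ×-⇔ ¬-cong-⇔ (InMOK-2^*⇔ (suc i) j)

V2is-2^*⇔ : ∀ {X} i j → V2is (i ℕ.+ j) (2^ j * X) ⇔ V2is i X
V2is-2^*⇔ i j = unsigned (2^[i+j]∣2^j*⇔ i j) ×-⇔ ¬-cong-⇔ (unsigned (2^[i+j]∣2^j*⇔ (suc i) j))
  where
  unsigned : ∀ {a b c d} → (a ∣ b ⇔ c ∣ d) → (a Unsigned.∣ b ⇔ c Unsigned.∣ d)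
  unsigned e = mk⇔ (∣⇒∣ᵤ ∘ to e ∘ ∣ᵤ⇒∣) (∣⇒∣ᵤ ∘ from e ∘ ∣ᵤ⇒∣)

star-2^*⇔ : ∀ i j → f ≡ 2^ j * f₁ → star (i ℕ.+ j) f B₀ (2^ j * X) Y Z ⇔ star i f₁ B₀ X Y Z′
star-2^*⇔ {f₁ = f₁} {B₀} {X} {Y} i j refl =
  subst (λ e → Exact2 (- B₀) (i ℕ.+ j) (2^ j * X) e ⇔ Exact2 (- B₀) i X (f₁ * Y))
    (sym (*-assoc (2^ j) f₁ Y)) (Exact2-2^*⇔ (- B₀) i j)

tstar-2^*⇔ : ∀ i j → f ≡ 2^ j * f₁ → tstar (i ℕ.+ j) f B₀ (2^ j * X) Y Z ⇔ tstar i f₁ B₀ X Y Z′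
tstar-2^*⇔ {B₀ = B₀} {X} {Z = Z} {Z′} i j f≡ =
  star-2^*⇔ {B₀ = B₀} {Z = Z} {Z′} (suc i) j f≡ ×-⇔ V2is-2^*⇔ {X} i j

star⇒2^t∣x : ∀ t → 2^ t ∣ f → star t f B₀ X Y Z → 2^ t ∣ X
star⇒2^t∣x {f} {B₀} {Y = Y} t 2^t∣f (u∈ , _) = InMOK-2^-∣ʳ⇒∣ˡ (- B₀) t u∈ (∣m⇒∣m*n Y 2^t∣f)

tstar⇒¬2^[1+i]∣f*y : ∀ i → (o : Obj n f B₀ C (tstar i)) → ¬ 2^ suc i ∣ f * y o
tstar⇒¬2^[1+i]∣f*y {B₀ = B₀} i o 2^[1+i]∣fy with (u∈ , _) , _ , 2^[1+i]∤x ← cond o =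
  2^[1+i]∤x (∣⇒∣ᵤ (InMOK-2*-∣ʳ⇒∣ˡ (- B₀) (2^ i) u∈ 2^[1+i]∣fy))

star∖tstar-2^*⇔ : ∀ i → f ≡ 2^ suc i * f₁ →
  (star (suc i) ∧c notc (tstar i)) f B₀ (2^ suc i * X) Y Z ⇔ star 0 f₁ B₀ X Y Z′
star∖tstar-2^*⇔ {f = f} {f₁} {B₀} {X} {Y} {Z} {Z′} i f≡ =
  mk⇔ (to rescale ∘ proj₁) (λ st → from rescale st , λ (_ , _ , 2^[1+i]∤x) → 2^[1+i]∤x 2^[1+i]∣x)
  where
  rescale : star (suc i) f B₀ (2^ suc i * X) Y Z ⇔ star 0 f₁ B₀ X Y Z′
  rescale = star-2^*⇔ {B₀ = B₀} {X} {Y} {Z} {Z′} 0 (suc i) f≡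
  2^[1+i]∣x : 2^ suc i Unsigned.∣ 2^ suc i * X
  2^[1+i]∣x = ∣⇒∣ᵤ (∣m⇒∣m*n X (∣-refl {2^ suc i}))

norm : ℤ → ℤ → ℤ → ℤ → ℤ
norm f B₀ X Y = X * X + f * f * B₀ * (Y * Y)

norm-rescale : ∀ α → f ≡ α * f₁ → X ≡ α * X₁ → norm f B₀ X Y ≡ α * α * norm f₁ B₀ X₁ Y
norm-rescale {f₁ = f₁} {X₁ = X₁} {B₀} {Y} α refl refl = identity α X₁ f₁ B₀ Y
  where
  identity : ∀ α X f B Y →
    α * X * (α * X) + α * f * (α * f) * B * (Y * Y) ≡ α * α * (X * X + f * f * B * (Y * Y))
  identity = solve-∀

rescaled-equation⇔ : ∀ α γ n .{{_ : NonZero α}} → f ≡ α * f₁ → α * α * C₁ ≡ C * γ ^ n →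
  (norm f₁ B₀ X Y ≡ C₁ * Z ^ n) ⇔ (norm f B₀ (α * X) Y ≡ C * (γ * Z) ^ n)
rescaled-equation⇔ {f} {f₁} {C₁} {C} {B₀} {X} {Y} {Z} α γ n f≡ C≡ = mk⇔
  (λ e → trans N≡ (trans (cong (α * α *_) e) (sym R≡)))
  (λ e → *-cancelˡ-≡ (α * α) _ _ {{i*j≢0 α α}} (trans (sym N≡) (trans e R≡)))
  where
  N≡ : norm f B₀ (α * X) Y ≡ α * α * norm f₁ B₀ X Y
  N≡ = norm-rescale {X₁ = X} {B₀ = B₀} {Y = Y} α f≡ refl
  R≡ : C * (γ * Z) ^ n ≡ α * α * (C₁ * Z ^ n)
  R≡ = begin
    C * (γ * Z) ^ n       ≡⟨ cong (C *_) (^-distrib-* γ Z n) ⟩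
    C * (γ ^ n * Z ^ n)   ≡⟨ *-assoc C (γ ^ n) (Z ^ n) ⟨
    C * γ ^ n * Z ^ n     ≡⟨ cong (_* Z ^ n) C≡ ⟨
    α * α * C₁ * Z ^ n    ≡⟨ *-assoc (α * α) C₁ (Z ^ n) ⟩
    α * α * (C₁ * Z ^ n)  ∎
    where open ≡-Reasoning

rescaled-coefficient : ∀ a c n d → C₁ ≡ C * 2^ d → 2 ℕ.* a ℕ.+ d ≡ c ℕ.* n →
                       2^ a * 2^ a * C₁ ≡ C * 2^ c ^ n
rescaled-coefficient {C = C} a c n d refl 2a+d≡cn = begin
  2^ a * 2^ a * (C * 2^ d)    ≡⟨ cong (_* (C * 2^ d)) (2^-double a) ⟨
  2^ (2 ℕ.* a) * (C * 2^ d)   ≡⟨ x∙yz≈y∙xz (2^ (2 ℕ.* a)) C (2^ d) ⟩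
  C * (2^ (2 ℕ.* a) * 2^ d)   ≡⟨ cong (C *_) (^-distribˡ-+-* (+ 2) (2 ℕ.* a) d) ⟨
  C * 2^ (2 ℕ.* a ℕ.+ d)      ≡⟨ cong (λ e → C * 2^ e) 2a+d≡cn ⟩
  C * 2^ (c ℕ.* n)            ≡⟨ cong (C *_) (^-*-assoc (+ 2) c n) ⟨
  C * 2^ c ^ n                ∎
  where open ≡-Reasoning

rescaled-action⇔ : ∀ α .{{_ : NonZero α}} u {v v′ w w′} → v ≡ α * w → v′ ≡ α * w′ →
                   (u * v ≡ v′) ⇔ (u * w ≡ w′)
rescaled-action⇔ α u {w = w} refl refl = mk⇔
  (λ e → *-cancelˡ-≡ α _ _ (trans (sym (x∙yz≈y∙xz u α w)) e))
  (λ e → trans (x∙yz≈y∙xz u α w) (cong (α *_) e))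

Primitive : ℤ → ℤ → ℤ → Set
Primitive X Y Z = ∀ (d : ℤ) → d Unsigned.∣ X → d Unsigned.∣ Y → d Unsigned.∣ Z → d Unsigned.∣ 1ℤ

primitive-unscale : ∀ α γ → Primitive (α * X) Y (γ * Z) → Primitive X Y Z
primitive-unscale {X} {Y} {Z} α γ pr d d∣X d∣Y d∣Z =
  pr d (∣⇒∣ᵤ (∣n⇒∣m*n α (∣ᵤ⇒∣ {d} {X} d∣X))) d∣Y (∣⇒∣ᵤ (∣n⇒∣m*n γ (∣ᵤ⇒∣ {d} {Z} d∣Z)))

odd∣2^*⇒∣ : ∀ i → Odd d → d Unsigned.∣ 2^ i * m → d Unsigned.∣ m
odd∣2^*⇒∣ {d} {m} zero    _     d∣m = subst (d Unsigned.∣_) (*-identityˡ m) d∣m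
odd∣2^*⇒∣ {d} {m} (suc i) d-odd d∣2^[1+i]m = odd∣2^*⇒∣ i d-odd
  (coprime-divisor d (+ 2) (2^ i * m) (¬2∣⇒coprime-2 (d-odd ∘ ∣ᵤ⇒∣))
    (subst (d Unsigned.∣_) (*-assoc (+ 2) (2^ i) m) d∣2^[1+i]m))

primitive-scale-2^ : ∀ i j → Odd Y → Primitive X Y Z → Primitive (2^ i * X) Y (2^ j * Z)
primitive-scale-2^ {Y} i j Y-odd pr d d∣X d∣Y d∣Z =
  pr d (odd∣2^*⇒∣ i d-odd d∣X) d∣Y (odd∣2^*⇒∣ j d-odd d∣Z)
  where
  d-odd : Odd d
  d-odd 2∣d = Y-odd (∣-trans 2∣d (∣ᵤ⇒∣ d∣Y))

even-x⇒odd-y : Odd C → (o : Obj n f B₀ C P) → Even (x o) → Odd (y o)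
even-x⇒odd-y {C} {n} {f} {B₀} C-odd o 2∣x 2∣y =
  odd-1 (∣ᵤ⇒∣ (prim o (+ 2) (∣⇒∣ᵤ 2∣x) (∣⇒∣ᵤ 2∣y) (∣⇒∣ᵤ 2∣z)))
  where
  2∣Czⁿ : Even (C * z o ^ n)
  2∣Czⁿ = subst Even (eqn o)
    (∣m∣n⇒∣m+n (∣m⇒∣m*n (x o) 2∣x) (∣n⇒∣m*n (f * f * B₀) (∣m⇒∣m*n (y o) 2∣y)))
  2∣z : Even (z o)
  2∣z = [ ⊥-elim ∘ C-odd , even[m^k]⇒even[m] n ]′ (even[m*n]⇒even[m]⊎even[n] C (z o ^ n) 2∣Czⁿ)

star0⇒odd-y : Even C → (o : Obj n f B₀ C (star 0)) → Odd (y o)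
star0⇒odd-y {C} {n} {f} {B₀} 2∣C o 2∣y = proj₂ (cond o) (InMOK-∣ (- B₀) 2∣x 2∣fy)
  where
  2∣fy : Even (f * y o)
  2∣fy = ∣n⇒∣m*n f 2∣y
  2∣x : Even (x o)
  2∣x = even[m*m+n]⇒even[m] (∣n⇒∣m*n (f * f * B₀) (∣m⇒∣m*n (y o) 2∣y))
    (subst Even (sym (eqn o)) (∣m⇒∣m*n (z o ^ n) 2∣C))

V2is⇒2^[1+r]∣f*y⇒even-y : V2is r f → 2^ suc r ∣ f * Y → Even Y
V2is⇒2^[1+r]∣f*y⇒even-y {r} {f} {Y} (2^r∣f , 2^[1+r]∤f) 2^[1+r]∣fY =
  [ ⊥-elim ∘ f′-not-even , id ]′
    (even[m*n]⇒even[m]⊎even[n] f′ Y (to (2^[i+j]∣2^j*⇔ 1 r) 2^[1+r]∣2^rf′Y))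
  where
  f′ : ℤ
  f′ = quotient (∣ᵤ⇒∣ {2^ r} {f} 2^r∣f)
  f≡ : f ≡ 2^ r * f′
  f≡ = quotient-≡ (∣ᵤ⇒∣ {2^ r} {f} 2^r∣f)
  2^[1+r]∣2^rf′Y : 2^ suc r ∣ 2^ r * (f′ * Y)
  2^[1+r]∣2^rf′Y = subst (2^ suc r ∣_) (trans (cong (_* Y) f≡) (*-assoc (2^ r) f′ Y)) 2^[1+r]∣fY
  f′-not-even : ¬ Even f′
  f′-not-even 2∣f′ = 2^[1+r]∤f (∣⇒∣ᵤ (subst (2^ suc r ∣_) (sym f≡) (from (2^[i+j]∣2^j*⇔ 1 r) 2∣f′)))

-- Rescaling (x, y, z) ↦ (x / 2ᵃ, y, z / 2ᶜ) as an equivalence of groupoids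

module Rescaling
  {n : ℕ} {B₀ f C f₁ C₁ : ℤ} {P Q : Cond} (a c : ℕ)
  (f≡ : f ≡ 2^ a * f₁) (C₁≡ : 2^ a * 2^ a * C₁ ≡ C * 2^ c ^ n)
  (C-odd : Odd C) (0<a : 0 ℕ.< a) (c-least : ∀ l → 2 ℕ.* a ℕ.≤ l ℕ.* n → c ℕ.≤ l)
  (2^a∣x : (o : Obj n f B₀ C P) → 2^ a ∣ x o)
  (P⇒Q : ∀ {X Y Z} → Odd Y → P f B₀ (2^ a * X) Y (2^ c * Z) → Q f₁ B₀ X Y Z)
  (Q⇒P : ∀ {X Y Z} → Q f₁ B₀ X Y Z → P f B₀ (2^ a * X) Y (2^ c * Z))
  (Q-odd-y : (o : Obj n f₁ B₀ C₁ Q) → Odd (y o))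
  where

  instance
    _ = 2^-nonZero a
    _ = 2^-nonZero c

  equation⇔ : (norm f₁ B₀ X Y ≡ C₁ * Z ^ n) ⇔ (norm f B₀ (2^ a * X) Y ≡ C * (2^ c * Z) ^ n)
  equation⇔ {X} {Y} {Z} = rescaled-equation⇔ {C = C} {B₀ = B₀} {X} {Y} {Z} (2^ a) (2^ c) n f≡ C₁≡

  module _ (o : Obj n f B₀ C P) where

    x₁ : ℤ
    x₁ = quotient (2^a∣x o)

    x≡ : x o ≡ 2^ a * x₁
    x≡ = quotient-≡ (2^a∣x o)

    2^[2a]∣Czⁿ : 2^ (2 ℕ.* a) ∣ C * z o ^ n
    2^[2a]∣Czⁿ = subst₂ _∣_ (sym (2^-double a))
      (trans (sym (norm-rescale {B₀ = B₀} {Y = y o} (2^ a) f≡ x≡)) (eqn o)) (∣m⇒∣m*n _ ∣-refl)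

    2^c∣z : 2^ c ∣ z o
    2^c∣z = 2^∣C*zⁿ⇒2^∣z n C-odd c-least 2^[2a]∣Czⁿ

    z₁ : ℤ
    z₁ = quotient 2^c∣z

    z≡ : z o ≡ 2^ c * z₁
    z≡ = quotient-≡ 2^c∣z

    shrink : Obj n f₁ B₀ C₁ Q
    shrink = sol x₁ (y o) z₁
      (from (equation⇔ {x₁} {y o} {z₁}) (rescaled (λ X Z → norm f B₀ X (y o) ≡ C * Z ^ n) (eqn o)))
      (primitive-unscale {x₁} {y o} {z₁} (2^ a) (2^ c)
        (rescaled (λ X Z → Primitive X (y o) Z) (prim o)))
      (P⇒Q y-odd (rescaled (λ X Z → P f B₀ X (y o) Z) (cond o)))
      where
      rescaled : (R : ℤ → ℤ → Set) → R (x o) (z o) → R (2^ a * x₁) (2^ c * z₁)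
      rescaled R = subst₂ R x≡ z≡
      y-odd : Odd (y o)
      y-odd = even-x⇒odd-y C-odd o (∣-trans (2^-mono-∣ 0<a) (2^a∣x o))

  shrink-hom⇔ : ∀ {o o′ : Obj n f B₀ C P} u →
    ((u ^ n * x o ≡ x o′) × (u ^ 2 * z o ≡ z o′)) ⇔
    ((u ^ n * x₁ o ≡ x₁ o′) × (u ^ 2 * z₁ o ≡ z₁ o′))
  shrink-hom⇔ {o} {o′} u =
    rescaled-action⇔ (2^ a) (u ^ n) (x≡ o) (x≡ o′) ×-⇔
    rescaled-action⇔ (2^ c) (u ^ 2) (z≡ o) (z≡ o′)

  shrink-hom : ∀ {o o′} → Hom o o′ → Hom (shrink o) (shrink o′)
  shrink-hom h = hom (unit h) (isUnit h) (proj₁ acts) (acty h) (proj₂ acts)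
    where acts = to (shrink-hom⇔ (unit h)) (actx h , actz h)

  unshrink-hom : ∀ {o o′} → Hom (shrink o) (shrink o′) → Hom o o′
  unshrink-hom h = hom (unit h) (isUnit h) (proj₁ acts) (acty h) (proj₂ acts)
    where acts = from (shrink-hom⇔ (unit h)) (actx h , actz h)

  expand : Obj n f₁ B₀ C₁ Q → Obj n f B₀ C P
  expand o = sol (2^ a * x o) (y o) (2^ c * z o) (to (equation⇔ {x o} {y o} {z o}) (eqn o))
    (primitive-scale-2^ a c (Q-odd-y o) (prim o)) (Q⇒P (cond o))

  shrink-expand : (o : Obj n f₁ B₀ C₁ Q) → Hom (shrink (expand o)) o
  shrink-expand o = hom 1ℤ refl
    (to (rescaled-action⇔ (2^ a) (1ℤ ^ n) (x≡ (expand o)) refl) (1^k*m≡m n))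
    (1^k*m≡m n)
    (to (rescaled-action⇔ (2^ c) (1ℤ ^ 2) (z≡ (expand o)) refl) (1^k*m≡m 2))
    where
    1^k*m≡m : ∀ {m} k → 1ℤ ^ k * m ≡ m
    1^k*m≡m {m} k = trans (cong (_* m) (^-zeroˡ k)) (*-identityˡ m)

  equiv : GpdEquiv n B₀ f C P f₁ C₁ Q
  equiv = record
    { F₀ = shrink
    ; F₁ = shrink-hom
    ; F-id = λ _ → refl
    ; F-∘ = λ _ _ → refl
    ; faithful = λ _ _ → id
    ; full = λ h → unshrink-hom h , refl
    ; essSurj = λ o → expand o , shrink-expand o
    }

star-empty-above : Odd C → V2is r f → suc r ℕ.< t → ¬ Obj n f B₀ C (star t)
star-empty-above {r = r} {f} {t = suc t} {B₀ = B₀} C-odd v₂f (s≤s r<t) o =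
  even-x⇒odd-y C-odd o 2∣x 2∣y
  where
  2^t∣u : 2^ t ∣ x o × 2^ t ∣ f * y o
  2^t∣u = InMOK-2*⇒∣ (- B₀) (2^ t) (proj₁ (cond o))
  2∣x : Even (x o)
  2∣x = ∣-trans (2^-mono-∣ (ℕP.≤-trans (s≤s z≤n) r<t)) (proj₁ 2^t∣u)
  2∣y : Even (y o)
  2∣y = V2is⇒2^[1+r]∣f*y⇒even-y {r} {f} v₂f (∣-trans (2^-mono-∣ r<t) (proj₂ 2^t∣u))

tstar-empty-below : 2^ r ∣ f → 0 ℕ.< t → t ℕ.≤ r → ¬ Obj n f B₀ C (tstar (t ℕ.∸ 1))
tstar-empty-below {t = suc s} 2^r∣f _ t≤r o =
  tstar⇒¬2^[1+i]∣f*y s o (∣m⇒∣m*n (y o) (∣-trans (2^-mono-∣ t≤r) 2^r∣f))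

star∖tstar-empty-top : Odd C → V2is r f → t ≡ suc r →
                       ¬ Obj n f B₀ C (star t ∧c notc (tstar (t ℕ.∸ 1)))
star∖tstar-empty-top {r = r} {f} {B₀ = B₀} C-odd v₂f refl o with 2^ suc r ∣? x o
... | yes 2^[1+r]∣x = even-x⇒odd-y C-odd o (∣-trans (2^-mono-∣ {j = suc r} (s≤s z≤n)) 2^[1+r]∣x)
  (V2is⇒2^[1+r]∣f*y⇒even-y {r} {f} v₂f
    (InMOK-2*-∣ˡ⇒∣ʳ (- B₀) (2^ r) (proj₁ (proj₁ (cond o))) 2^[1+r]∣x))
... | no  2^[1+r]∤x = proj₂ (cond o) (proj₁ (cond o) ,
  ∣⇒∣ᵤ (proj₁ (InMOK-2*⇒∣ (- B₀) (2^ r) (proj₁ (proj₁ (cond o))))) , 2^[1+r]∤x ∘ ∣ᵤ⇒∣)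

star-solution⇒n∣2t : ∀ t .{{_ : ℕ.NonZero n}} → Odd C → 2^ suc t ∣ f →
                     norm f B₀ X Y ≡ C * Z ^ n → star t f B₀ X Y Z → n ℕD.∣ 2 ℕ.* t
star-solution⇒n∣2t {n} {C} {f} {B₀} {X} {Y} {Z} t C-odd 2^[1+t]∣f N≡Czⁿ st@(_ , u∉) =
  C*zⁿ≡2^i*odd⇒n∣i n C-odd N′-odd (begin
    C * Z ^ n           ≡⟨ N≡Czⁿ ⟨
    norm f B₀ X Y       ≡⟨ norm-rescale {B₀ = B₀} {Y = Y} (2^ t) f≡ X≡ ⟩
    2^ t * 2^ t * N′    ≡⟨ cong (_* N′) (2^-double t) ⟨
    2^ (2 ℕ.* t) * N′   ∎)
  where
  open ≡-Reasoning
  2^t∣f : 2^ t ∣ f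
  2^t∣f = ∣-trans (2^-mono-∣ (ℕP.n≤1+n t)) 2^[1+t]∣f
  2^t∣X : 2^ t ∣ X
  2^t∣X = star⇒2^t∣x {B₀ = B₀} {Y = Y} {Z = Z} t 2^t∣f st
  f′ = quotient 2^t∣f
  f≡ = quotient-≡ 2^t∣f
  X′ = quotient 2^t∣X
  X≡ = quotient-≡ 2^t∣X
  N′ = norm f′ B₀ X′ Y
  X′-odd : Odd X′
  X′-odd 2∣X′ = u∉ (InMOK-∣ (- B₀)
    (subst (2^ suc t ∣_) (sym X≡) (from (2^[i+j]∣2^j*⇔ 1 t) 2∣X′)) (∣m⇒∣m*n Y 2^[1+t]∣f))
  f′-even : Even f′
  f′-even = to (2^[i+j]∣2^j*⇔ 1 t) (subst (2^ suc t ∣_) f≡ 2^[1+t]∣f)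
  N′-odd : Odd N′
  N′-odd = X′-odd ∘ even[m*m+n]⇒even[m] (∣m⇒∣m*n (Y * Y) (∣m⇒∣m*n B₀ (∣m⇒∣m*n f′ f′-even)))

star∖tstar-empty-below : .{{_ : ℕ.NonZero n}} → Odd C → 2^ r ∣ f → ¬ (2 ℕD.∣ n) → t ℕ.< r →
                         ¬ (n ℕD.∣ t) → ¬ Obj n f B₀ C (star t ∧c notc (tstar (t ℕ.∸ 1)))
star∖tstar-empty-below {t = t} C-odd 2^r∣f 2∤n t<r n∤t o = n∤t (odd∣2*⇒∣ 2∤n
  (star-solution⇒n∣2t t C-odd (∣-trans (2^-mono-∣ t<r) 2^r∣f) (eqn o) (proj₁ (cond o))))

ceilDiv-coefficient : ∀ C r n .{{_ : ℕ.NonZero n}} →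
  2^ r * 2^ r * (C * 2^ (ceilDiv (2 ℕ.* r) n ℕ.* n ℕ.∸ 2 ℕ.* r)) ≡ C * 2^ ceilDiv (2 ℕ.* r) n ^ n
ceilDiv-coefficient C r n = rescaled-coefficient {C = C} r (ceilDiv (2 ℕ.* r) n) n _ refl
  (ℕP.m+[n∸m]≡n (ceilDiv-upper (2 ℕ.* r) n))

tstar-top-equiv : .{{_ : ℕ.NonZero n}} → Odd C → 0 ℕ.< r → t ≡ suc r → ∀ f₁ → f ≡ 2^ r * f₁ →
  GpdEquiv n B₀ f C (tstar (t ℕ.∸ 1))
           f₁ (C * 2^ (ceilDiv (2 ℕ.* r) n ℕ.* n ℕ.∸ 2 ℕ.* r)) (tstar 0)
tstar-top-equiv {n} {C} {r} {f = f} {B₀ = B₀} C-odd 0<r refl f₁ f≡ =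
  Rescaling.equiv r c f≡ (ceilDiv-coefficient C r n) C-odd 0<r (ceilDiv-least (2 ℕ.* r) n)
    (λ o → ∣ᵤ⇒∣ {2^ r} {x o} (proj₁ (proj₂ (cond o))))
    (λ {X} {Y} {Z} _ → to (rescale X Y Z))
    (λ {X} {Y} {Z} → from (rescale X Y Z))
    (λ o 2∣y → tstar⇒¬2^[1+i]∣f*y 0 o (∣n⇒∣m*n f₁ 2∣y))
  where
  c = ceilDiv (2 ℕ.* r) n
  rescale : ∀ X Y Z → tstar r f B₀ (2^ r * X) Y (2^ c * Z) ⇔ tstar 0 f₁ B₀ X Y Z
  rescale X Y Z = tstar-2^*⇔ {B₀ = B₀} {X} {Y} {2^ c * Z} {Z} 0 r f≡

star∖tstar-divisible-equiv : .{{_ : ℕ.NonZero n}} → Odd C → 0 ℕ.< t → n ℕD.∣ t →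
  ∀ f₁ → f ≡ 2^ t * f₁ →
  GpdEquiv n B₀ f C (star t ∧c notc (tstar (t ℕ.∸ 1))) f₁ C (star 0 ∧c yOdd)
star∖tstar-divisible-equiv {n} {C} {t = t@(suc s)} {f} {B₀} C-odd 0<t (ℕD.divides j t≡jn) f₁ f≡ =
  Rescaling.equiv t (2 ℕ.* j) f≡
    (rescaled-coefficient {C} {C} t (2 ℕ.* j) n 0 (sym (*-identityʳ C)) 2t+0≡2jn)
    C-odd 0<t c-least
    (λ o → star⇒2^t∣x {B₀ = B₀} {Y = y o} {Z = z o} t 2^t∣f (proj₁ (cond o)))
    (λ {X} {Y} {Z} Y-odd p → to (rescale X Y Z) p , Y-odd ∘ ∣ᵤ⇒∣ {+ 2} {Y})
    (λ {X} {Y} {Z} (st , _) → from (rescale X Y Z) st)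
    (λ o 2∣y → proj₂ (cond o) (∣⇒∣ᵤ 2∣y))
  where
  2t+0≡2jn : 2 ℕ.* t ℕ.+ 0 ≡ 2 ℕ.* j ℕ.* n
  2t+0≡2jn = trans (ℕP.+-identityʳ _) (trans (cong (2 ℕ.*_) t≡jn) (sym (ℕP.*-assoc 2 j n)))
  c-least : ∀ l → 2 ℕ.* t ℕ.≤ l ℕ.* n → 2 ℕ.* j ℕ.≤ l
  c-least l 2t≤ln = ℕP.*-cancelʳ-≤ (2 ℕ.* j) l n
    (subst (ℕ._≤ l ℕ.* n) (trans (sym (ℕP.+-identityʳ _)) 2t+0≡2jn) 2t≤ln)
  2^t∣f = divides f₁ (trans f≡ (*-comm (2^ t) f₁))
  rescale : ∀ X Y Z → (star t ∧c notc (tstar s)) f B₀ (2^ t * X) Y (2^ (2 ℕ.* j) * Z) ⇔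
                      star 0 f₁ B₀ X Y Z
  rescale X Y Z = star∖tstar-2^*⇔ {B₀ = B₀} {X} {Y} {2^ (2 ℕ.* j) * Z} {Z} s f≡

star∖tstar-top-equiv : .{{_ : ℕ.NonZero n}} → Odd C → ¬ (2 ℕD.∣ n) → 0 ℕ.< r →
  t ≡ r → ¬ (n ℕD.∣ t) → ∀ f₁ → f ≡ 2^ r * f₁ →
  GpdEquiv n B₀ f C (star t ∧c notc (tstar (t ℕ.∸ 1)))
           f₁ (C * 2^ (ceilDiv (2 ℕ.* r) n ℕ.* n ℕ.∸ 2 ℕ.* r)) (star 0)
star∖tstar-top-equiv {n} {C} {r = r@(suc s)} {f = f} {B₀ = B₀} C-odd 2∤n 0<r refl n∤r f₁ f≡ =
  Rescaling.equiv r c f≡ (ceilDiv-coefficient C r n) C-odd 0<r (ceilDiv-least (2 ℕ.* r) n)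
    (λ o → star⇒2^t∣x {B₀ = B₀} {Y = y o} {Z = z o} r 2^r∣f (proj₁ (cond o)))
    (λ {X} {Y} {Z} _ → to (rescale X Y Z))
    (λ {X} {Y} {Z} → from (rescale X Y Z))
    (star0⇒odd-y (∣n⇒∣m*n C (2^-mono-∣ (ℕP.m<n⇒0<n∸m 2r<cn))))
  where
  c = ceilDiv (2 ℕ.* r) n
  2r<cn : 2 ℕ.* r ℕ.< c ℕ.* n
  2r<cn = ℕP.≤∧≢⇒< (ceilDiv-upper (2 ℕ.* r) n)
    (λ 2r≡cn → n∤r (odd∣2*⇒∣ 2∤n (ℕD.divides c 2r≡cn)))
  2^r∣f = divides f₁ (trans f≡ (*-comm (2^ r) f₁))
  rescale : ∀ X Y Z → (star r ∧c notc (tstar s)) f B₀ (2^ r * X) Y (2^ c * Z) ⇔ star 0 f₁ B₀ X Y Z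
  rescale X Y Z = star∖tstar-2^*⇔ {B₀ = B₀} {X} {Y} {2^ c * Z} {Z} s f≡

lemma6p3 : ∀ (n : ℕ) (f B₀ C : ℤ) (r : ℕ) →
  3 ℕ.≤ n → ¬ (2 ℕD.∣ n) →
  f ≢ 0ℤ → B₀ ≢ 0ℤ → C ≢ 0ℤ → B₀ ≢ -1ℤ → SquarefreeZ B₀ → Coprime f C →
  0 ℕ.< r → V2is r f →
  ∀ (t : ℕ) →
    -- t > r+1 : 𝒴_{B,C}(ℤ; *₂ᵗ) = ∅
    ((suc r ℕ.< t → ¬ Obj n f B₀ C (star t))
    -- 0 < t ≤ r : 𝒴_{B,C}(ℤ; ~*₂^{t-1}) = ∅
    × (0 ℕ.< t → t ℕ.≤ r → ¬ Obj n f B₀ C (tstar (t ℕ.∸ 1)))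
    -- t = r+1 : 𝒴_{B,C}(ℤ; ~*₂^{t-1}) ≅ 𝒴 with B2^(-2r), C2^(ceil(2r/n)n-2r)(ℤ; ~*₂⁰)
    × (t ≡ suc r → ∀ (f₁ : ℤ) → f ≡ (+ 2) ^ r * f₁ →
         GpdEquiv n B₀ f C (tstar (t ℕ.∸ 1))
                  f₁ (C * (+ 2) ^ (ceilDiv (2 ℕ.* r) n ℕ.* n ℕ.∸ 2 ℕ.* r)) (tstar 0))
    -- complement, 0 < t < r, n ∤ t : empty
    × (0 ℕ.< t → t ℕ.< r → ¬ (n ℕD.∣ t) →
         ¬ Obj n f B₀ C (star t ∧c notc (tstar (t ℕ.∸ 1))))
    -- complement, 0 < t ≤ r, n ∣ t : ≅ 𝒴 with B2^(-2t), C(ℤ; *₂⁰, 2 ∤ y)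
    × (0 ℕ.< t → t ℕ.≤ r → n ℕD.∣ t → ∀ (f₁ : ℤ) → f ≡ (+ 2) ^ t * f₁ →
         GpdEquiv n B₀ f C (star t ∧c notc (tstar (t ℕ.∸ 1)))
                  f₁ C (star 0 ∧c yOdd))
    -- complement, t = r, n ∤ t : ≅ 𝒴 with B2^(-2r), C2^(ceil(2r/n)n-2r)(ℤ; *₂⁰)
    × (t ≡ r → ¬ (n ℕD.∣ t) → ∀ (f₁ : ℤ) → f ≡ (+ 2) ^ r * f₁ →
         GpdEquiv n B₀ f C (star t ∧c notc (tstar (t ℕ.∸ 1)))
                  f₁ (C * (+ 2) ^ (ceilDiv (2 ℕ.* r) n ℕ.* n ℕ.∸ 2 ℕ.* r)) (star 0))
    -- complement, t = r+1 : empty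
    × (t ≡ suc r → ¬ Obj n f B₀ C (star t ∧c notc (tstar (t ℕ.∸ 1)))))
lemma6p3 n f B₀ C r 3≤n 2∤n _ _ _ _ _ f⊥C 0<r v₂f t =
    star-empty-above C-odd v₂f
  , tstar-empty-below 2^r∣f
  , tstar-top-equiv C-odd 0<r
  , (λ _ → star∖tstar-empty-below C-odd 2^r∣f 2∤n)
  , (λ 0<t _ → star∖tstar-divisible-equiv C-odd 0<t)
  , star∖tstar-top-equiv C-odd 2∤n 0<r
  , star∖tstar-empty-top C-odd v₂f
  where
  instance
    _ : ℕ.NonZero n
    _ = ℕ.>-nonZero (ℕP.≤-trans (s≤s z≤n) 3≤n)
  2^r∣f : 2^ r ∣ f
  2^r∣f = ∣ᵤ⇒∣ {2^ r} {f} (proj₁ v₂f)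
  C-odd : Odd C
  C-odd = coprime-even⇒odd f⊥C (∣-trans (2^-mono-∣ 0<r) 2^r∣f)
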